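{- Let $G$ be a finite simple graph and let $u,v\in V(G)$ be distinct vertices that are not adjacent in $G$. Let $e=uv$ and $H=G+e$. If $(G;v)\preceq_s(G;u)$, then $(H;v)\preceq_s(H;u)$. Moreover, if $(G;v)\prec_s(G;u)$, then $(H;v)\prec_s(H;u)$.
   Context: A semi-edge walk of length $k$ in a graph $G$ is an alternating sequence $v_1e_1v_2e_2\ldots v_ke_kv_{k+1}$ with $v_i\in V(G)$, $e_i\in E(G)$, such that for each $i$ the vertices $v_i$ and $v_{i+1}$ are (not necessarily distinct) endpoints of $e_i$. For $x,y\in V(G)$, $SW_k(G;x,y)$ denotes the set of semi-edge walks of length $k$ in $G$ starting at $x$ and ending at $y$, and $SW_k(G;x)=SW_k(G;x,x)$. For graphs $G,G'$ and vertices $x,y\in V(G)$, $x',y'\in V(G')$, write $(G;x,y)\preceq_s(G';x',y')$ if $|SW_k(G;x,y)|\le|SW_k(G';x',y')|$ for every $k\ge0$, and $(G;x,y)\prec_s(G';x',y')$ if moreover strict inequality holds for some $k$. $(G;x)$ abbreviates $(G;x,x)$. -}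

module Defs where

open import Data.Nat using (ℕ; zero; suc; _+_; _*_; _≤_; _<_)
open import Data.Bool using (Bool; true; false; _∧_; _∨_; if_then_else_)
open import Data.Fin using (Fin; _<?_)
open import Data.Fin.Properties using (_≟_)
open import Data.List using (List; map; allFin)
open import Data.Nat.ListAction using (sum)
open import Data.Product using (_×_; _,_; ∃-syntax)
open import Relation.Binary.PropositionalEquality using (_≡_; _≢_)
open import Relation.Nullary.Decidable using (⌊_⌋)

Graph : ℕ → Set
Graph n = Fin n → Fin n → Bool

IsSimple : {n : ℕ} → Graph n → Set
IsSimple {n} G = ((x y : Fin n) → G x y ≡ G y x) × ((x : Fin n) → G x x ≡ false)

Σᵥ : {n : ℕ} → (Fin n → ℕ) → ℕ
Σᵥ {n} f = sum (map f (allFin n))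

-- Edges of G: each edge {i,j} is represented exactly once as the ordered
-- pair (i , j) with i < j and G i j = true.
isEdge : {n : ℕ} → Graph n → Fin n → Fin n → Bool
isEdge G i j = ⌊ i <? j ⌋ ∧ G i j

endpoint : {n : ℕ} → Fin n → Fin n → Fin n → Bool
endpoint x i j = ⌊ x ≟ i ⌋ ∨ ⌊ x ≟ j ⌋

χ : Bool → ℕ
χ b = if b then 1 else 0

-- |SW_k(G;x,y)|: the number of alternating sequences x=v₁ e₁ v₂ … e_k v_{k+1}=y
-- where v_i and v_{i+1} are (not necessarily distinct) endpoints of e_i.
sw : {n : ℕ} → Graph n → ℕ → Fin n → Fin n → ℕ
sw G zero x y = χ ⌊ x ≟ y ⌋
sw G (suc k) x y =
  Σᵥ λ i → Σᵥ λ j → χ (isEdge G i j) *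
    Σᵥ λ w → χ (endpoint x i j ∧ endpoint w i j) * sw G k w y

_⪯ₛ_ : {n m : ℕ} → (Graph n × Fin n × Fin n) → (Graph m × Fin m × Fin m) → Set
(G , x , y) ⪯ₛ (G' , x' , y') = (k : ℕ) → sw G k x y ≤ sw G' k x' y'

_≺ₛ_ : {n m : ℕ} → (Graph n × Fin n × Fin n) → (Graph m × Fin m × Fin m) → Set
(G , x , y) ≺ₛ (G' , x' , y') =
  ((G , x , y) ⪯ₛ (G' , x' , y')) × ∃[ k ] (sw G k x y < sw G' k x' y')

addEdge : {n : ℕ} → Graph n → Fin n → Fin n → Graph n
addEdge G u v a b =
  G a b ∨ (⌊ a ≟ u ⌋ ∧ ⌊ b ≟ v ⌋) ∨ (⌊ a ≟ v ⌋ ∧ ⌊ b ≟ u ⌋)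

-- The counts sw G k x y are the entries of the k-th power of the symmetric matrix
-- Q = D + A (degrees plus adjacency), and adding the edge uv replaces Q by the
-- rank-one update N = Q + s sᵀ with s = e_u + e_v.  Unrolling N^(k+1) f = Q (N^k f) + ⟨s, N^k f⟩ s gives
--   N^k f = Q^k f + Σ_{j<k} ⟨s, N^j f⟩ Q^(k-1-j) s,
-- so each return count of N is that of Q plus a correction.  Symmetry of Q turns the
-- hypothesis into (Q^a s)_v ≤ (Q^a s)_u; the expansion with f = s then yields
-- (N^j s)_v ≤ (N^j s)_u, and these are the correction coefficients ⟨s, N^j e_y⟩ = (N^j s)_y.
-- Hence the correction at v is dominated term by term by the one at u, and strictness
-- of the Q-part survives.

module Submission where

open import Defs
open import Data.Nat using (ℕ; zero; suc; _+_; _*_; _≤_; _<_)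
open import Data.Nat.Properties
  using (+-*-semiring; +-identityʳ; +-assoc; +-comm; *-zeroʳ; *-identityˡ; *-comm; *-assoc;
         *-distribˡ-+; *-distribʳ-+; ≤-refl; +-mono-≤; +-monoʳ-≤; *-mono-≤; +-mono-<-≤;
         module ≤-Reasoning)
open import Data.Nat.Tactic.RingSolver using (solve-∀)
open import Data.Fin using (Fin; zero; suc; _<?_)
open import Data.Fin.Properties using (_≟_; suc-injective; <-asym; <-cmp)
open import Data.Bool using (true; false; _∧_; _∨_)
open import Data.Bool.Properties using (∨-comm; ∧-comm)
open import Data.Product using (_×_; _,_)
open import Data.Empty using (⊥-elim)
open import Data.List using (tabulate)
open import Data.List.Properties using (map-tabulate)
import Data.Nat.ListAction as List
open import Data.Vec.Functional using (Vector)
open import Algebra.Properties.Semiring.Sum +-*-semiring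
  using (sum-syntax; sum-replicate-zero; sum-cong-≗; ∑-distrib-+; ∑-comm; *-distribˡ-sum; *-distribʳ-sum)
open import Function using (_∘_)
open import Relation.Binary.Definitions using (tri<; tri≈; tri>)
open import Relation.Binary.PropositionalEquality
  using (_≡_; _≢_; _≗_; refl; sym; trans; cong; cong₂; subst₂; module ≡-Reasoning)
open import Relation.Nullary.Decidable using (⌊_⌋; ⌊⌋-map′; yes; no)

Σᵥ≡∑ : {n : ℕ} (f : Fin n → ℕ) → Σᵥ f ≡ ∑[ w < n ] f w
Σᵥ≡∑ {n} f = trans (cong List.sum (map-tabulate (λ w → w) f)) (sum-tabulate f)
  where
  sum-tabulate : ∀ {m} (g : Fin m → ℕ) → List.sum (tabulate g) ≡ ∑[ w < m ] g w
  sum-tabulate {zero}  g = refl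
  sum-tabulate {suc m} g = cong (g zero +_) (sum-tabulate (g ∘ suc))

δ : {n : ℕ} → Fin n → Vector ℕ n
δ y w = χ ⌊ w ≟ y ⌋

∑-δ : {n : ℕ} (y : Fin n) (f : Vector ℕ n) → ∑[ w < n ] (δ y w * f w) ≡ f y
∑-δ {suc n} zero    f = trans (cong₂ _+_ (+-identityʳ (f zero)) (sum-replicate-zero n)) (+-identityʳ (f zero))
∑-δ {suc n} (suc y) f = begin
  ∑[ w < n ] (χ ⌊ suc w ≟ suc y ⌋ * f (suc w))
    ≡⟨ sum-cong-≗ (λ w → cong (λ b → χ b * f (suc w)) (⌊⌋-map′ (cong suc) suc-injective (w ≟ y))) ⟩
  ∑[ w < n ] (δ y w * f (suc w))
    ≡⟨ ∑-δ y (f ∘ suc) ⟩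
  f (suc y) ∎
  where open ≡-Reasoning

∑²-δ : {m n : ℕ} (a : Fin m) (b : Fin n) (F : Fin m → Fin n → ℕ) →
  ∑[ i < m ] ∑[ j < n ] (δ a i * δ b j * F i j) ≡ F a b
∑²-δ {m} {n} a b F = begin
  ∑[ i < m ] ∑[ j < n ] (δ a i * δ b j * F i j)
    ≡⟨ sum-cong-≗ (λ i → sum-cong-≗ (λ j → regroup (δ a i) (δ b j) (F i j))) ⟩
  ∑[ i < m ] ∑[ j < n ] (δ b j * (δ a i * F i j))
    ≡⟨ sum-cong-≗ (λ i → ∑-δ b (λ j → δ a i * F i j)) ⟩
  ∑[ i < m ] (δ a i * F i b)
    ≡⟨ ∑-δ a (λ i → F i b) ⟩
  F a b ∎
  where
  open ≡-Reasoning
  regroup : ∀ p q r → p * q * r ≡ q * (p * r)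
  regroup = solve-∀

∑-distrib-+₃ : {n : ℕ} (f g h : Vector ℕ n) →
  ∑[ i < n ] (f i + g i + h i) ≡ ∑[ i < n ] f i + ∑[ i < n ] g i + ∑[ i < n ] h i
∑-distrib-+₃ f g h =
  trans (∑-distrib-+ (λ i → f i + g i) h) (cong (_+ ∑[ i < _ ] h i) (∑-distrib-+ f g))

∑²-distrib-+₃ : {m n : ℕ} (f g h : Fin m → Fin n → ℕ) →
  ∑[ i < m ] ∑[ j < n ] (f i j + g i j + h i j)
    ≡ ∑[ i < m ] ∑[ j < n ] f i j + ∑[ i < m ] ∑[ j < n ] g i j + ∑[ i < m ] ∑[ j < n ] h i j
∑²-distrib-+₃ f g h =
  trans (sum-cong-≗ (λ i → ∑-distrib-+₃ (f i) (g i) (h i)))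
        (∑-distrib-+₃ (λ i → ∑[ j < _ ] f i j) (λ i → ∑[ j < _ ] g i j) (λ i → ∑[ j < _ ] h i j))

∑²-*-∑ : {m n : ℕ} (c : Fin m → Fin m → ℕ) (A : Fin n → Fin m → Fin m → ℕ) (h : Vector ℕ n) →
  ∑[ i < m ] ∑[ j < m ] (c i j * ∑[ w < n ] (A w i j * h w))
    ≡ ∑[ w < n ] (∑[ i < m ] ∑[ j < m ] (c i j * A w i j) * h w)
∑²-*-∑ {m} {n} c A h = begin
  ∑[ i < m ] ∑[ j < m ] (c i j * ∑[ w < n ] (A w i j * h w))
    ≡⟨ sum-cong-≗ (λ i → sum-cong-≗ (λ j → *-distribˡ-sum (c i j) (λ w → A w i j * h w))) ⟩
  ∑[ i < m ] ∑[ j < m ] ∑[ w < n ] (c i j * (A w i j * h w))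
    ≡⟨ sum-cong-≗ (λ i → ∑-comm (λ j w → c i j * (A w i j * h w))) ⟩
  ∑[ i < m ] ∑[ w < n ] ∑[ j < m ] (c i j * (A w i j * h w))
    ≡⟨ ∑-comm (λ i w → ∑[ j < m ] (c i j * (A w i j * h w))) ⟩
  ∑[ w < n ] ∑[ i < m ] ∑[ j < m ] (c i j * (A w i j * h w))
    ≡⟨ sum-cong-≗ (λ w → sum-cong-≗ (λ i → sum-cong-≗ (λ j → *-assoc (c i j) (A w i j) (h w)))) ⟨
  ∑[ w < n ] ∑[ i < m ] ∑[ j < m ] (c i j * A w i j * h w)
    ≡⟨ sum-cong-≗ (λ w → trans (*-distribʳ-sum (h w) (λ i → ∑[ j < m ] (c i j * A w i j)))
                                (sum-cong-≗ (λ i → *-distribʳ-sum (h w) (λ j → c i j * A w i j)))) ⟨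
  ∑[ w < n ] (∑[ i < m ] ∑[ j < m ] (c i j * A w i j) * h w) ∎
  where open ≡-Reasoning

Matrix : ℕ → Set
Matrix n = Fin n → Fin n → ℕ

SymmetricMatrix : {n : ℕ} → Matrix n → Set
SymmetricMatrix {n} M = (x w : Fin n) → M x w ≡ M w x

_·ᵥ_ : {n : ℕ} → Matrix n → Vector ℕ n → Vector ℕ n
(_·ᵥ_ {n} M f) x = ∑[ w < n ] (M x w * f w)

_^_·ᵥ_ : {n : ℕ} → Matrix n → ℕ → Vector ℕ n → Vector ℕ n
M ^ zero  ·ᵥ f = f
M ^ suc k ·ᵥ f = M ·ᵥ (M ^ k ·ᵥ f)

⟨_,_⟩ : {n : ℕ} → Vector ℕ n → Vector ℕ n → ℕ
⟨_,_⟩ {n} f g = ∑[ w < n ] (f w * g w)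

⟨-,δ⟩ : {n : ℕ} (h : Vector ℕ n) (y : Fin n) → ⟨ h , δ y ⟩ ≡ h y
⟨-,δ⟩ h y = trans (sum-cong-≗ (λ w → *-comm (h w) (δ y w))) (∑-δ y h)

module _ {n : ℕ} (M : Matrix n) where

  ·ᵥ-cong : {f g : Vector ℕ n} → f ≗ g → M ·ᵥ f ≗ M ·ᵥ g
  ·ᵥ-cong f≗g x = sum-cong-≗ (λ w → cong (M x w *_) (f≗g w))

  ·ᵥ-distrib-+ : (f g : Vector ℕ n) (x : Fin n) →
    (M ·ᵥ (λ w → f w + g w)) x ≡ (M ·ᵥ f) x + (M ·ᵥ g) x
  ·ᵥ-distrib-+ f g x =
    trans (sum-cong-≗ (λ w → *-distribˡ-+ (M x w) (f w) (g w))) (∑-distrib-+ (λ w → M x w * f w) (λ w → M x w * g w))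

  ^·ᵥ-distrib-+ : (k : ℕ) (f g : Vector ℕ n) (x : Fin n) →
    (M ^ k ·ᵥ (λ w → f w + g w)) x ≡ (M ^ k ·ᵥ f) x + (M ^ k ·ᵥ g) x
  ^·ᵥ-distrib-+ zero    f g x = refl
  ^·ᵥ-distrib-+ (suc k) f g x =
    trans (·ᵥ-cong (^·ᵥ-distrib-+ k f g) x) (·ᵥ-distrib-+ (M ^ k ·ᵥ f) (M ^ k ·ᵥ g) x)

  ·ᵥ-*ˡ : (c : ℕ) (f : Vector ℕ n) (x : Fin n) → (M ·ᵥ (λ w → c * f w)) x ≡ c * (M ·ᵥ f) x
  ·ᵥ-*ˡ c f x = begin
    ∑[ w < n ] (M x w * (c * f w))  ≡⟨ sum-cong-≗ (λ w → regroup (M x w) c (f w)) ⟩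
    ∑[ w < n ] (c * (M x w * f w))  ≡⟨ *-distribˡ-sum c (λ w → M x w * f w) ⟨
    c * (M ·ᵥ f) x                  ∎
    where
    open ≡-Reasoning
    regroup : ∀ m c a → m * (c * a) ≡ c * (m * a)
    regroup = solve-∀

  ^·ᵥ-sucʳ : (k : ℕ) (f : Vector ℕ n) → M ^ k ·ᵥ (M ·ᵥ f) ≗ M ^ suc k ·ᵥ f
  ^·ᵥ-sucʳ zero    f = λ _ → refl
  ^·ᵥ-sucʳ (suc k) f = ·ᵥ-cong (^·ᵥ-sucʳ k f)

  module _ (M-sym : SymmetricMatrix M) where

    ⟨-,·ᵥ⟩ : (f g : Vector ℕ n) → ⟨ f , M ·ᵥ g ⟩ ≡ ⟨ M ·ᵥ f , g ⟩
    ⟨-,·ᵥ⟩ f g = begin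
      ∑[ x < n ] (f x * ∑[ w < n ] (M x w * g w))
        ≡⟨ sum-cong-≗ (λ x → *-distribˡ-sum (f x) (λ w → M x w * g w)) ⟩
      ∑[ x < n ] ∑[ w < n ] (f x * (M x w * g w))
        ≡⟨ ∑-comm (λ x w → f x * (M x w * g w)) ⟩
      ∑[ w < n ] ∑[ x < n ] (f x * (M x w * g w))
        ≡⟨ sum-cong-≗ (λ w → sum-cong-≗ (λ x → regroup (f x) (M x w) (M w x) (g w) (M-sym x w))) ⟩
      ∑[ w < n ] ∑[ x < n ] (M w x * f x * g w)
        ≡⟨ sum-cong-≗ (λ w → *-distribʳ-sum (g w) (λ x → M w x * f x)) ⟨
      ⟨ M ·ᵥ f , g ⟩ ∎
      where
      open ≡-Reasoning
      regroup : ∀ a m m' b → m ≡ m' → a * (m * b) ≡ m' * a * b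
      regroup a m m' b refl = trans (sym (*-assoc a m b)) (cong (_* b) (*-comm a m))

    ⟨-,^·ᵥ⟩ : (k : ℕ) (f g : Vector ℕ n) → ⟨ f , M ^ k ·ᵥ g ⟩ ≡ ⟨ M ^ k ·ᵥ f , g ⟩
    ⟨-,^·ᵥ⟩ zero    f g = refl
    ⟨-,^·ᵥ⟩ (suc k) f g = begin
      ⟨ f , M ·ᵥ (M ^ k ·ᵥ g) ⟩        ≡⟨ ⟨-,·ᵥ⟩ f (M ^ k ·ᵥ g) ⟩
      ⟨ M ·ᵥ f , M ^ k ·ᵥ g ⟩          ≡⟨ ⟨-,^·ᵥ⟩ k (M ·ᵥ f) g ⟩
      ⟨ M ^ k ·ᵥ (M ·ᵥ f) , g ⟩        ≡⟨ sum-cong-≗ (λ w → cong (_* g w) (^·ᵥ-sucʳ k f w)) ⟩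
      ⟨ M ^ suc k ·ᵥ f , g ⟩           ∎
      where open ≡-Reasoning

    ^·ᵥ-δ-sym : (k : ℕ) (a b : Fin n) → (M ^ k ·ᵥ δ a) b ≡ (M ^ k ·ᵥ δ b) a
    ^·ᵥ-δ-sym k a b = begin
      (M ^ k ·ᵥ δ a) b          ≡⟨ ∑-δ b (M ^ k ·ᵥ δ a) ⟨
      ⟨ δ b , M ^ k ·ᵥ δ a ⟩    ≡⟨ ⟨-,^·ᵥ⟩ k (δ b) (δ a) ⟩
      ⟨ M ^ k ·ᵥ δ b , δ a ⟩    ≡⟨ ⟨-,δ⟩ (M ^ k ·ᵥ δ b) a ⟩
      (M ^ k ·ᵥ δ b) a          ∎
      where open ≡-Reasoning

  ·ᵥ-zero : (x : Fin n) → (M ·ᵥ (λ _ → 0)) x ≡ 0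
  ·ᵥ-zero x = trans (sum-cong-≗ (λ w → *-zeroʳ (M x w))) (sum-replicate-zero n)

module RankOneUpdate {n : ℕ} (Q N : Matrix n) (s : Vector ℕ n)
  (N≡Q+ssᵀ : ∀ x w → N x w ≡ Q x w + s x * s w) where

  N·ᵥ-expand : (h : Vector ℕ n) (x : Fin n) → (N ·ᵥ h) x ≡ (Q ·ᵥ h) x + s x * ⟨ s , h ⟩
  N·ᵥ-expand h x = begin
    ∑[ w < n ] (N x w * h w)
      ≡⟨ sum-cong-≗ (λ w → trans (cong (_* h w) (N≡Q+ssᵀ x w)) (expand (Q x w) (s x) (s w) (h w))) ⟩
    ∑[ w < n ] (Q x w * h w + s x * (s w * h w))
      ≡⟨ ∑-distrib-+ (λ w → Q x w * h w) (λ w → s x * (s w * h w)) ⟩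
    (Q ·ᵥ h) x + ∑[ w < n ] (s x * (s w * h w))
      ≡⟨ cong ((Q ·ᵥ h) x +_) (*-distribˡ-sum (s x) (λ w → s w * h w)) ⟨
    (Q ·ᵥ h) x + s x * ⟨ s , h ⟩ ∎
    where
    open ≡-Reasoning
    expand : ∀ q a b c → (q + a * b) * c ≡ q * c + a * (b * c)
    expand = solve-∀

  -- correction c k = Σ_{j<k} c j · Q^(k-1-j) s, unfolded at j = 0.
  correction : (ℕ → ℕ) → ℕ → Vector ℕ n
  correction c zero    x = 0
  correction c (suc k) x = c 0 * (Q ^ k ·ᵥ s) x + correction (c ∘ suc) k x

  correction-suc : (c : ℕ → ℕ) (k : ℕ) (x : Fin n) →
    (Q ·ᵥ correction c k) x + c k * s x ≡ correction c (suc k) x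
  correction-suc c zero    x = trans (cong (_+ c 0 * s x) (·ᵥ-zero Q x)) (sym (+-identityʳ _))
  correction-suc c (suc k) x = begin
    (Q ·ᵥ correction c (suc k)) x + c (suc k) * s x
      ≡⟨ cong (_+ c (suc k) * s x) (trans (·ᵥ-distrib-+ Q (λ w → c 0 * (Q ^ k ·ᵥ s) w) (correction (c ∘ suc) k) x)
                                          (cong (_+ (Q ·ᵥ correction (c ∘ suc) k) x) (·ᵥ-*ˡ Q (c 0) (Q ^ k ·ᵥ s) x))) ⟩
    c 0 * (Q ^ suc k ·ᵥ s) x + (Q ·ᵥ correction (c ∘ suc) k) x + c (suc k) * s x
      ≡⟨ +-assoc (c 0 * (Q ^ suc k ·ᵥ s) x) _ _ ⟩
    c 0 * (Q ^ suc k ·ᵥ s) x + ((Q ·ᵥ correction (c ∘ suc) k) x + c (suc k) * s x)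
      ≡⟨ cong (c 0 * (Q ^ suc k ·ᵥ s) x +_) (correction-suc (c ∘ suc) k x) ⟩
    correction c (suc (suc k)) x ∎
    where open ≡-Reasoning

  ^·ᵥ-decomposition : (k : ℕ) (f : Vector ℕ n) (x : Fin n) →
    (N ^ k ·ᵥ f) x ≡ (Q ^ k ·ᵥ f) x + correction (λ j → ⟨ s , N ^ j ·ᵥ f ⟩) k x
  ^·ᵥ-decomposition zero    f x = sym (+-identityʳ (f x))
  ^·ᵥ-decomposition (suc k) f x = begin
    (N ·ᵥ (N ^ k ·ᵥ f)) x
      ≡⟨ N·ᵥ-expand (N ^ k ·ᵥ f) x ⟩
    (Q ·ᵥ (N ^ k ·ᵥ f)) x + s x * c k
      ≡⟨ cong₂ _+_ (trans (·ᵥ-cong Q (^·ᵥ-decomposition k f) x) (·ᵥ-distrib-+ Q (Q ^ k ·ᵥ f) (correction c k) x))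
                   (*-comm (s x) (c k)) ⟩
    (Q ^ suc k ·ᵥ f) x + (Q ·ᵥ correction c k) x + c k * s x
      ≡⟨ +-assoc ((Q ^ suc k ·ᵥ f) x) _ _ ⟩
    (Q ^ suc k ·ᵥ f) x + ((Q ·ᵥ correction c k) x + c k * s x)
      ≡⟨ cong ((Q ^ suc k ·ᵥ f) x +_) (correction-suc c k x) ⟩
    (Q ^ suc k ·ᵥ f) x + correction c (suc k) x ∎
    where
    open ≡-Reasoning
    c : ℕ → ℕ
    c j = ⟨ s , N ^ j ·ᵥ f ⟩

  correction-mono : {u v : Fin n} → (∀ a → (Q ^ a ·ᵥ s) v ≤ (Q ^ a ·ᵥ s) u) →
    {c c′ : ℕ → ℕ} → (∀ j → c j ≤ c′ j) → ∀ k → correction c k v ≤ correction c′ k u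
  correction-mono Qs-mono c≤c′ zero    = ≤-refl
  correction-mono Qs-mono c≤c′ (suc k) =
    +-mono-≤ (*-mono-≤ (c≤c′ 0) (Qs-mono k)) (correction-mono Qs-mono (c≤c′ ∘ suc) k)

module AddedEdgeComparison {n : ℕ} (Q N : Matrix n) (u v : Fin n) (Q-sym : SymmetricMatrix Q)
  (N≡Q+ssᵀ : ∀ x w → N x w ≡ Q x w + (δ u x + δ v x) * (δ u w + δ v w))
  (Q-returns-≤ : ∀ k → (Q ^ k ·ᵥ δ v) v ≤ (Q ^ k ·ᵥ δ u) u) where

  private
    s : Vector ℕ n
    s x = δ u x + δ v x

  open RankOneUpdate Q N s N≡Q+ssᵀ

  N-sym : SymmetricMatrix N
  N-sym x w = begin
    N x w              ≡⟨ N≡Q+ssᵀ x w ⟩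
    Q x w + s x * s w  ≡⟨ cong₂ _+_ (Q-sym x w) (*-comm (s x) (s w)) ⟩
    Q w x + s w * s x  ≡⟨ N≡Q+ssᵀ w x ⟨
    N w x              ∎
    where open ≡-Reasoning

  Q^·ᵥs-mono : ∀ a → (Q ^ a ·ᵥ s) v ≤ (Q ^ a ·ᵥ s) u
  Q^·ᵥs-mono a = begin
    (Q ^ a ·ᵥ s) v                          ≡⟨ ^·ᵥ-distrib-+ Q a (δ u) (δ v) v ⟩
    (Q ^ a ·ᵥ δ u) v + (Q ^ a ·ᵥ δ v) v     ≡⟨ cong (_+ (Q ^ a ·ᵥ δ v) v) (^·ᵥ-δ-sym Q Q-sym a u v) ⟩
    (Q ^ a ·ᵥ δ v) u + (Q ^ a ·ᵥ δ v) v     ≤⟨ +-monoʳ-≤ ((Q ^ a ·ᵥ δ v) u) (Q-returns-≤ a) ⟩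
    (Q ^ a ·ᵥ δ v) u + (Q ^ a ·ᵥ δ u) u     ≡⟨ +-comm ((Q ^ a ·ᵥ δ v) u) _ ⟩
    (Q ^ a ·ᵥ δ u) u + (Q ^ a ·ᵥ δ v) u     ≡⟨ ^·ᵥ-distrib-+ Q a (δ u) (δ v) u ⟨
    (Q ^ a ·ᵥ s) u                          ∎
    where open ≤-Reasoning

  N^·ᵥs-mono : ∀ k → (N ^ k ·ᵥ s) v ≤ (N ^ k ·ᵥ s) u
  N^·ᵥs-mono k = subst₂ _≤_ (sym (^·ᵥ-decomposition k s v)) (sym (^·ᵥ-decomposition k s u))
    (+-mono-≤ (Q^·ᵥs-mono k) (correction-mono Q^·ᵥs-mono (λ _ → ≤-refl) k))

  ⟨s,N^·ᵥδ⟩ : ∀ j y → ⟨ s , N ^ j ·ᵥ δ y ⟩ ≡ (N ^ j ·ᵥ s) y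
  ⟨s,N^·ᵥδ⟩ j y = trans (⟨-,^·ᵥ⟩ N N-sym j s (δ y)) (⟨-,δ⟩ (N ^ j ·ᵥ s) y)

  returns-correction-mono : ∀ k →
    correction (λ j → ⟨ s , N ^ j ·ᵥ δ v ⟩) k v ≤ correction (λ j → ⟨ s , N ^ j ·ᵥ δ u ⟩) k u
  returns-correction-mono = correction-mono Q^·ᵥs-mono
    (λ j → subst₂ _≤_ (sym (⟨s,N^·ᵥδ⟩ j v)) (sym (⟨s,N^·ᵥδ⟩ j u)) (N^·ᵥs-mono j))

  N-returns-≤ : ∀ k → (N ^ k ·ᵥ δ v) v ≤ (N ^ k ·ᵥ δ u) u
  N-returns-≤ k = subst₂ _≤_ (sym (^·ᵥ-decomposition k (δ v) v)) (sym (^·ᵥ-decomposition k (δ u) u))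
    (+-mono-≤ (Q-returns-≤ k) (returns-correction-mono k))

  N-returns-< : ∀ k → (Q ^ k ·ᵥ δ v) v < (Q ^ k ·ᵥ δ u) u → (N ^ k ·ᵥ δ v) v < (N ^ k ·ᵥ δ u) u
  N-returns-< k Q< = subst₂ _<_ (sym (^·ᵥ-decomposition k (δ v) v)) (sym (^·ᵥ-decomposition k (δ u) u))
    (+-mono-<-≤ Q< (returns-correction-mono k))

-- Entry (x , w) counts the edges having both x and w as endpoints:
-- the degree on the diagonal, adjacency off it.
walkMatrix : {n : ℕ} → Graph n → Matrix n
walkMatrix {n} G x w = ∑[ i < n ] ∑[ j < n ] (χ (isEdge G i j) * χ (endpoint x i j ∧ endpoint w i j))

walkMatrix-sym : {n : ℕ} (G : Graph n) → SymmetricMatrix (walkMatrix G)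
walkMatrix-sym G x w = sum-cong-≗ (λ i → sum-cong-≗ (λ j →
  cong (λ b → χ (isEdge G i j) * χ b) (∧-comm (endpoint x i j) (endpoint w i j))))

sw≡walkMatrix^·ᵥδ : {n : ℕ} (G : Graph n) (k : ℕ) (x y : Fin n) → sw G k x y ≡ (walkMatrix G ^ k ·ᵥ δ y) x
sw≡walkMatrix^·ᵥδ G zero    x y = refl
sw≡walkMatrix^·ᵥδ {n} G (suc k) x y = begin
  sw G (suc k) x y
    ≡⟨ Σᵥ≡∑-cong (λ i → Σᵥ≡∑-cong (λ j → cong (χ (isEdge G i j) *_) (Σᵥ≡∑-cong (λ w → cong (A w i j *_) (sw≡walkMatrix^·ᵥδ G k w y))))) ⟩
  ∑[ i < n ] ∑[ j < n ] (χ (isEdge G i j) * ∑[ w < n ] (A w i j * (walkMatrix G ^ k ·ᵥ δ y) w))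
    ≡⟨ ∑²-*-∑ (λ i j → χ (isEdge G i j)) A (walkMatrix G ^ k ·ᵥ δ y) ⟩
  (walkMatrix G ^ suc k ·ᵥ δ y) x ∎
  where
  open ≡-Reasoning
  A : Fin n → Fin n → Fin n → ℕ
  A w i j = χ (endpoint x i j ∧ endpoint w i j)
  Σᵥ≡∑-cong : {f g : Vector ℕ n} → f ≗ g → Σᵥ f ≡ ∑[ w < n ] g w
  Σᵥ≡∑-cong {f} f≗g = trans (Σᵥ≡∑ f) (sum-cong-≗ f≗g)

χ-∧ : ∀ a b → χ (a ∧ b) ≡ χ a * χ b
χ-∧ true  b = sym (+-identityʳ (χ b))
χ-∧ false b = refl

endpoint-swap : {n : ℕ} (x i j : Fin n) → endpoint x i j ≡ endpoint x j i
endpoint-swap x i j = ∨-comm ⌊ x ≟ i ⌋ ⌊ x ≟ j ⌋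

χ-∨-false : ∀ b → χ (b ∨ false) ≡ χ b + 0 + 0
χ-∨-false true  = refl
χ-∨-false false = refl

module _ {n : ℕ} (G : Graph n) {u v : Fin n} (u≢v : u ≢ v) (Guv : G u v ≡ false) (Gvu : G v u ≡ false) where

  χ-addEdge : ∀ i j → χ (addEdge G u v i j) ≡ χ (G i j) + δ u i * δ v j + δ v i * δ u j
  χ-addEdge i j with i ≟ u | j ≟ v | i ≟ v | j ≟ u
  ... | yes refl | yes refl | yes u≡v  | _        = ⊥-elim (u≢v u≡v)
  ... | yes refl | yes refl | no _     | yes v≡u  = ⊥-elim (u≢v (sym v≡u))
  ... | yes refl | yes refl | no _     | no _     rewrite Guv = refl
  ... | yes refl | no _     | yes u≡v  | _        = ⊥-elim (u≢v u≡v)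
  ... | yes _    | no _     | no _     | _        = χ-∨-false (G i j)
  ... | no _     | _        | yes refl | yes refl rewrite Gvu = refl
  ... | no _     | _        | yes _    | no _     = χ-∨-false (G i j)
  ... | no _     | _        | no _     | _        = χ-∨-false (G i j)

  χ-endpoint : ∀ x → χ (endpoint x u v) ≡ δ u x + δ v x
  χ-endpoint x with x ≟ u | x ≟ v
  ... | yes refl | yes u≡v = ⊥-elim (u≢v u≡v)
  ... | yes _    | no _    = refl
  ... | no _     | yes _   = refl
  ... | no _     | no _    = refl

  χ-<?-exclusive : χ ⌊ u <? v ⌋ + χ ⌊ v <? u ⌋ ≡ 1
  χ-<?-exclusive with u <? v | v <? u
  ... | yes u<v | yes v<u = ⊥-elim (<-asym u<v v<u)
  ... | yes _   | no _    = refl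
  ... | no _    | yes _   = refl
  ... | no u≮v  | no v≮u  with <-cmp u v
  ...   | tri< u<v _   _   = ⊥-elim (u≮v u<v)
  ...   | tri≈ _   u≡v _   = ⊥-elim (u≢v u≡v)
  ...   | tri> _   _   v<u = ⊥-elim (v≮u v<u)

  walkMatrix-addEdge : ∀ x w →
    walkMatrix (addEdge G u v) x w ≡ walkMatrix G x w + (δ u x + δ v x) * (δ u w + δ v w)
  walkMatrix-addEdge x w = begin
    walkMatrix (addEdge G u v) x w
      ≡⟨ sum-cong-≗ (λ i → sum-cong-≗ (λ j → split i j)) ⟩
    ∑[ i < n ] ∑[ j < n ] (χ (isEdge G i j) * A i j + δ u i * δ v j * F i j + δ v i * δ u j * F i j)
      ≡⟨ ∑²-distrib-+₃ (λ i j → χ (isEdge G i j) * A i j) (λ i j → δ u i * δ v j * F i j) (λ i j → δ v i * δ u j * F i j) ⟩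
    walkMatrix G x w + ∑[ i < n ] ∑[ j < n ] (δ u i * δ v j * F i j) + ∑[ i < n ] ∑[ j < n ] (δ v i * δ u j * F i j)
      ≡⟨ cong₂ (λ p q → walkMatrix G x w + p + q) (∑²-δ u v F) (∑²-δ v u F) ⟩
    walkMatrix G x w + F u v + F v u
      ≡⟨ +-assoc (walkMatrix G x w) (F u v) (F v u) ⟩
    walkMatrix G x w + (F u v + F v u)
      ≡⟨ cong (walkMatrix G x w +_) new-edge ⟩
    walkMatrix G x w + (δ u x + δ v x) * (δ u w + δ v w) ∎
    where
    open ≡-Reasoning
    A F : Fin n → Fin n → ℕ
    A i j = χ (endpoint x i j ∧ endpoint w i j)
    F i j = χ ⌊ i <? j ⌋ * A i j

    distribute : ∀ l g p q a → l * (g + p + q) * a ≡ l * g * a + p * (l * a) + q * (l * a)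
    distribute = solve-∀

    split : ∀ i j → χ (isEdge (addEdge G u v) i j) * A i j
                  ≡ χ (isEdge G i j) * A i j + δ u i * δ v j * F i j + δ v i * δ u j * F i j
    split i j = begin
      χ (⌊ i <? j ⌋ ∧ addEdge G u v i j) * A i j
        ≡⟨ cong (_* A i j) (trans (χ-∧ ⌊ i <? j ⌋ _) (cong (χ ⌊ i <? j ⌋ *_) (χ-addEdge i j))) ⟩
      χ ⌊ i <? j ⌋ * (χ (G i j) + δ u i * δ v j + δ v i * δ u j) * A i j
        ≡⟨ distribute (χ ⌊ i <? j ⌋) (χ (G i j)) (δ u i * δ v j) (δ v i * δ u j) (A i j) ⟩
      χ ⌊ i <? j ⌋ * χ (G i j) * A i j + δ u i * δ v j * F i j + δ v i * δ u j * F i j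
        ≡⟨ cong (λ e → e * A i j + δ u i * δ v j * F i j + δ v i * δ u j * F i j) (χ-∧ ⌊ i <? j ⌋ (G i j)) ⟨
      χ (isEdge G i j) * A i j + δ u i * δ v j * F i j + δ v i * δ u j * F i j ∎

    -- isEdge records the new edge once, as whichever of (u , v) and (v , u) is increasing.
    new-edge : F u v + F v u ≡ (δ u x + δ v x) * (δ u w + δ v w)
    new-edge = begin
      χ ⌊ u <? v ⌋ * A u v + χ ⌊ v <? u ⌋ * A v u
        ≡⟨ cong (λ e → χ ⌊ u <? v ⌋ * A u v + χ ⌊ v <? u ⌋ * e)
                (cong₂ (λ p q → χ (p ∧ q)) (endpoint-swap x v u) (endpoint-swap w v u)) ⟩
      χ ⌊ u <? v ⌋ * A u v + χ ⌊ v <? u ⌋ * A u v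
        ≡⟨ *-distribʳ-+ (A u v) (χ ⌊ u <? v ⌋) (χ ⌊ v <? u ⌋) ⟨
      (χ ⌊ u <? v ⌋ + χ ⌊ v <? u ⌋) * A u v
        ≡⟨ trans (cong (_* A u v) χ-<?-exclusive) (*-identityˡ (A u v)) ⟩
      A u v
        ≡⟨ χ-∧ (endpoint x u v) (endpoint w u v) ⟩
      χ (endpoint x u v) * χ (endpoint w u v)
        ≡⟨ cong₂ _*_ (χ-endpoint x) (χ-endpoint w) ⟩
      (δ u x + δ v x) * (δ u w + δ v w) ∎

lemma2p5 : {n : ℕ} (G : Graph n) → IsSimple G → (u v : Fin n) → u ≢ v → G u v ≡ false →
    (((G , v , v) ⪯ₛ (G , u , u)) → ((addEdge G u v , v , v) ⪯ₛ (addEdge G u v , u , u)))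
    × (((G , v , v) ≺ₛ (G , u , u)) → ((addEdge G u v , v , v) ≺ₛ (addEdge G u v , u , u)))
lemma2p5 G (G-sym , _) u v u≢v Guv = ⪯ₛ-preserved , ≺ₛ-preserved
  where
  H : Graph _
  H = addEdge G u v

  module Compare (G-returns : (G , v , v) ⪯ₛ (G , u , u)) =
    AddedEdgeComparison (walkMatrix G) (walkMatrix H) u v (walkMatrix-sym G)
      (walkMatrix-addEdge G u≢v Guv (trans (G-sym v u) Guv))
      (λ k → subst₂ _≤_ (sw≡walkMatrix^·ᵥδ G k v v) (sw≡walkMatrix^·ᵥδ G k u u) (G-returns k))

  ⪯ₛ-preserved : (G , v , v) ⪯ₛ (G , u , u) → (H , v , v) ⪯ₛ (H , u , u)
  ⪯ₛ-preserved G-returns k =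
    subst₂ _≤_ (sym (sw≡walkMatrix^·ᵥδ H k v v)) (sym (sw≡walkMatrix^·ᵥδ H k u u))
      (Compare.N-returns-≤ G-returns k)

  ≺ₛ-preserved : (G , v , v) ≺ₛ (G , u , u) → (H , v , v) ≺ₛ (H , u , u)
  ≺ₛ-preserved (G-returns , k , G<) = ⪯ₛ-preserved G-returns , k ,
    subst₂ _<_ (sym (sw≡walkMatrix^·ᵥδ H k v v)) (sym (sw≡walkMatrix^·ᵥδ H k u u))
      (Compare.N-returns-< G-returns k
        (subst₂ _<_ (sw≡walkMatrix^·ᵥδ G k v v) (sw≡walkMatrix^·ᵥδ G k u u) G<))
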